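{- Let $G=(V,E)$ be a finite, undirected, unweighted, simple, connected graph with $N=|V|$ nodes, and let $d_1\ge d_2\ge\dots\ge d_N$ be its degree sequence listed in non-increasing order. Let $n_1\in\{0,1,\dots,N\}$ and $n_0=N-n_1$, and let each node $i$ carry a binary characteristic $c_i\in\{0,1\}$ such that exactly $n_1$ nodes have $c_i=1$. Let $m_{11}$ denote the number of edges both of whose endpoints have characteristic $1$. Then $$m_{11}\ge LBm_{11}:=\max\Bigg(0,\ \bigg\lfloor \frac{\sum_{i=N-n_1+1}^{N} d_i-\sum_{i=1}^{n_0} d_i}{2}\bigg\rfloor\Bigg).$$
   Context: The degree $d_i$ of a node is the number of edges incident to it. $\sum_{i=N-n_1+1}^{N} d_i$ is the sum of the $n_1$ smallest degrees (the "tail" of length $n_1$ of the non-increasingly ordered degree sequence), and $\sum_{i=1}^{n_0} d_i$ is the sum of the $n_0$ largest degrees (the "head" of length $n_0$); empty sums are $0$. -}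

module Defs where

open import Data.Bool using (Bool; true; false; _∧_; if_then_else_)
open import Data.Nat using (ℕ; zero; suc; _+_; _∸_; _<ᵇ_; _/_)
open import Data.Nat.Properties using (≤-decTotalOrder)
open import Data.Fin using (Fin; toℕ)
open import Data.Nat.ListAction using (sum)
open import Data.List using (List; []; _∷_; map; take; drop; reverse; cartesianProduct; length)
open import Data.List.Base using (allFin)
open import Data.Product using (_×_; _,_)
open import Relation.Binary.PropositionalEquality using (_≡_)
import Data.List.Sort as Sort

record SimpleGraph (N : ℕ) : Set where
  field
    adj       : Fin N → Fin N → Bool
    adj-sym   : ∀ i j → adj i j ≡ adj j i
    adj-irrefl : ∀ i → adj i i ≡ false
open SimpleGraph public

count : {A : Set} → (A → Bool) → List A → ℕ
count p []       = 0
count p (x ∷ xs) = if p x then suc (count p xs) else count p xs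

data Reach {N : ℕ} (G : SimpleGraph N) : Fin N → Fin N → Set where
  here  : ∀ {i} → Reach G i i
  there : ∀ {i k j} → adj G i k ≡ true → Reach G k j → Reach G i j

Connected : {N : ℕ} → SimpleGraph N → Set
Connected {N} G = ∀ (i j : Fin N) → Reach G i j

degree : {N : ℕ} → SimpleGraph N → Fin N → ℕ
degree {N} G i = count (adj G i) (allFin N)

open Sort ≤-decTotalOrder using (sort)

degreeSeq : {N : ℕ} → SimpleGraph N → List ℕ
degreeSeq {N} G = reverse (sort (map (degree G) (allFin N)))

headSum : {N : ℕ} → SimpleGraph N → ℕ → ℕ
headSum G n0 = sum (take n0 (degreeSeq G))

tailSum : {N : ℕ} → SimpleGraph N → ℕ → ℕ
tailSum {N} G n1 = sum (drop (N ∸ n1) (degreeSeq G))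

numOnes : {N : ℕ} → (Fin N → Bool) → ℕ
numOnes {N} c = count c (allFin N)

m11 : {N : ℕ} → SimpleGraph N → (Fin N → Bool) → ℕ
m11 {N} G c = count (λ { (i , j) → (toℕ i <ᵇ toℕ j) ∧ adj G i j ∧ c i ∧ c j })
                    (cartesianProduct (allFin N) (allFin N))

-- LB m11 = max(0, ⌊(tail − head)/2⌋), computed in ℕ as (tail ∸ head) / 2
-- (if tail − head ≤ 0 the floor is ≤ 0 and the max is 0; otherwise they agree).
LBm11 : {N : ℕ} → SimpleGraph N → ℕ → ℕ
LBm11 {N} G n1 = (tailSum G n1 ∸ headSum G (N ∸ n1)) / 2

-- Double counting: the degrees of the 1-nodes add up to 2 m₁₁ plus the number of edges
-- joining a 1-node to a 0-node, and each such edge is counted again in the degree of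
-- its 0-endpoint, so Σ_{cᵢ=1} dᵢ ≤ 2 m₁₁ + Σ_{cᵢ=0} dᵢ. The n₀ nodes of characteristic 0
-- have total degree at most the sum of the n₀ largest degrees, hence
-- tail + head = Σ dᵢ ≤ 2 m₁₁ + 2 head.
module Submission where

open import Defs
open import Data.Bool using (Bool; true; false; _∧_; not; if_then_else_)
open import Data.Bool.Properties using (∧-comm; T-≡; ¬-not)
open import Data.Fin using (Fin; toℕ; zero; suc)
open import Data.Fin.Properties using (toℕ-injective)
open import Data.List
  using (List; []; _∷_; _++_; [_]; map; take; drop; reverse; length; tabulate; allFin; cartesianProduct)
open import Data.List.Properties using (map-∘; map-tabulate; length-tabulate; take++drop≡id; unfold-reverse)
open import Data.List.Membership.Propositional.Properties using (∈-map⁻; ∈-∃++)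
open import Data.List.Relation.Unary.All as All using (All; []; _∷_)
open import Data.List.Relation.Unary.AllPairs using (AllPairs; []; _∷_)
import Data.List.Relation.Unary.AllPairs.Properties as AllPairs
open import Data.List.Relation.Unary.Any using (here)
open import Data.List.Relation.Unary.Linked.Properties using (Linked⇒AllPairs)
open import Data.List.Relation.Binary.Permutation.Propositional using (_↭_; ↭-sym; ↭-trans)
open import Data.List.Relation.Binary.Permutation.Propositional.Properties
  using (map⁺; shift; drop-∷; ↭-reverse; ∈-resp-↭; ↭-empty-inv; All-resp-↭)
open import Data.Nat using (ℕ; zero; suc; _+_; _*_; _∸_; _≤_; _≥_; _<_; _<ᵇ_; _/_; z≤n)
open import Data.Nat.Properties
open import Algebra.Properties.CommutativeMonoid.Sum +-0-commutativeMonoid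
  using (sum-syntax; sum-cong-≗; ∑-comm; ∑-distrib-+)
open import Algebra.Properties.CommutativeSemigroup +-commutativeSemigroup
  using (x∙yz≈y∙xz)
open import Algebra.Properties.Semiring.Sum +-*-semiring using (*-distribˡ-sum)
open import Data.Nat.DivMod using (/-mono-≤; m*n/n≡m)
open import Data.Nat.ListAction using (sum)
open import Data.Nat.ListAction.Properties using (sum-↭; sum-++)
open import Data.Product using (_×_; _,_; proj₁; proj₂)
open import Function using (_∘_; flip; id; Equivalence)
open import Level using (Level)
open import Relation.Binary using (Rel; tri<; tri≈; tri>)
open import Relation.Binary.PropositionalEquality
  using (_≡_; refl; sym; trans; cong; cong₂; subst; subst₂; module ≡-Reasoning)
open import Relation.Nullary using (¬_)
import Data.List.Sort as Sort
open Sort ≤-decTotalOrder using (sort; sort-↭; sort-↗)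

private
  variable
    a ℓ : Level
    A B : Set a

𝟙 : Bool → ℕ
𝟙 b = if b then 1 else 0

𝟙-∧ : ∀ x y → 𝟙 (x ∧ y) ≡ 𝟙 x * 𝟙 y
𝟙-∧ false y = refl
𝟙-∧ true  y = sym (+-identityʳ (𝟙 y))

𝟙+𝟙-not : ∀ x → 𝟙 x + 𝟙 (not x) ≡ 1
𝟙+𝟙-not false = refl
𝟙+𝟙-not true  = refl

𝟙-<ᵇ-< : ∀ {m n} → m < n → 𝟙 (m <ᵇ n) ≡ 1
𝟙-<ᵇ-< m<n = cong 𝟙 (Equivalence.to T-≡ (<⇒<ᵇ m<n))

𝟙-<ᵇ-≮ : ∀ {m n} → ¬ m < n → 𝟙 (m <ᵇ n) ≡ 0
𝟙-<ᵇ-≮ m≮n = cong 𝟙 (¬-not (m≮n ∘ <ᵇ⇒< _ _ ∘ Equivalence.from T-≡))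

𝟙-split : ∀ a x y → 𝟙 x * 𝟙 a ≡ 𝟙 (a ∧ x ∧ y) + 𝟙 (a ∧ x ∧ not y)
𝟙-split false false y     = refl
𝟙-split false true  y     = refl
𝟙-split true  false y     = refl
𝟙-split true  true  false = refl
𝟙-split true  true  true  = refl

𝟙-∧-≤ : ∀ a x y → 𝟙 (a ∧ x ∧ y) ≤ 𝟙 y * 𝟙 a
𝟙-∧-≤ false x     y = z≤n
𝟙-∧-≤ true  false y = z≤n
𝟙-∧-≤ true  true  y = ≤-reflexive (sym (*-identityʳ (𝟙 y)))

count≡sum : (p : A → Bool) (xs : List A) → count p xs ≡ sum (map (𝟙 ∘ p) xs)
count≡sum p []       = refl
count≡sum p (x ∷ xs) with p x
... | true  = cong suc (count≡sum p xs)
... | false = count≡sum p xs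

count-↭ : (p : A → Bool) {xs ys : List A} → xs ↭ ys → count p xs ≡ count p ys
count-↭ p {xs} {ys} xs↭ys = begin
  count p xs             ≡⟨ count≡sum p xs ⟩
  sum (map (𝟙 ∘ p) xs)   ≡⟨ sum-↭ (map⁺ (𝟙 ∘ p) xs↭ys) ⟩
  sum (map (𝟙 ∘ p) ys)   ≡⟨ count≡sum p ys ⟨
  count p ys             ∎
  where open ≡-Reasoning

count-++ : (p : A → Bool) (xs ys : List A) → count p (xs ++ ys) ≡ count p xs + count p ys
count-++ p []       ys = refl
count-++ p (x ∷ xs) ys with p x
... | true  = cong suc (count-++ p xs ys)
... | false = count-++ p xs ys

count-map : (p : B → Bool) (f : A → B) (xs : List A) → count p (map f xs) ≡ count (p ∘ f) xs
count-map p f []       = refl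
count-map p f (x ∷ xs) with p (f x)
... | true  = cong suc (count-map p f xs)
... | false = count-map p f xs

count+count-not : (p : A → Bool) (xs : List A) → count p xs + count (not ∘ p) xs ≡ length xs
count+count-not p []       = refl
count+count-not p (x ∷ xs) with p x
... | true  = cong suc (count+count-not p xs)
... | false = trans (+-suc (count p xs) _) (cong suc (count+count-not p xs))

count-cartesianProduct : (p : A × B → Bool) (xs : List A) (ys : List B) →
  count p (cartesianProduct xs ys) ≡ sum (map (λ x → count (λ y → p (x , y)) ys) xs)
count-cartesianProduct p []       ys = refl
count-cartesianProduct p (x ∷ xs) ys = begin
  count p (map (x ,_) ys ++ cartesianProduct xs ys)
    ≡⟨ count-++ p (map (x ,_) ys) (cartesianProduct xs ys) ⟩
  count p (map (x ,_) ys) + count p (cartesianProduct xs ys)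
    ≡⟨ cong₂ _+_ (count-map p (x ,_) ys) (count-cartesianProduct p xs ys) ⟩
  count (λ y → p (x , y)) ys + sum (map (λ x → count (λ y → p (x , y)) ys) xs)
    ∎
  where open ≡-Reasoning

sum-tabulate : ∀ n (f : Fin n → ℕ) → sum (tabulate f) ≡ ∑[ i < n ] f i
sum-tabulate zero    f = refl
sum-tabulate (suc n) f = cong (f zero +_) (sum-tabulate n (λ i → f (suc i)))

sum-map-allFin : ∀ n (f : Fin n → ℕ) → sum (map f (allFin n)) ≡ ∑[ i < n ] f i
sum-map-allFin n f = trans (cong sum (map-tabulate id f)) (sum-tabulate n f)

count-allFin : ∀ n (p : Fin n → Bool) → count p (allFin n) ≡ ∑[ i < n ] 𝟙 (p i)
count-allFin n p = trans (count≡sum p (allFin n)) (sum-map-allFin n (𝟙 ∘ p))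

∑-mono-≤ : ∀ n {f g : Fin n → ℕ} → (∀ i → f i ≤ g i) → ∑[ i < n ] f i ≤ ∑[ i < n ] g i
∑-mono-≤ zero    f≤g = z≤n
∑-mono-≤ (suc n) f≤g = +-mono-≤ (f≤g zero) (∑-mono-≤ n (λ i → f≤g (suc i)))

∑-split : ∀ n (p : Fin n → Bool) (f : Fin n → ℕ) →
  ∑[ i < n ] f i ≡ ∑[ i < n ] (𝟙 (p i) * f i) + ∑[ i < n ] (𝟙 (not (p i)) * f i)
∑-split n p f = trans (sum-cong-≗ split) (∑-distrib-+ (λ i → 𝟙 (p i) * f i) (λ i → 𝟙 (not (p i)) * f i))
  where
  split : ∀ i → f i ≡ 𝟙 (p i) * f i + 𝟙 (not (p i)) * f i
  split i = begin
    f i                                   ≡⟨ *-identityˡ (f i) ⟨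
    1 * f i                               ≡⟨ cong (_* f i) (𝟙+𝟙-not (p i)) ⟨
    (𝟙 (p i) + 𝟙 (not (p i))) * f i       ≡⟨ *-distribʳ-+ (f i) (𝟙 (p i)) (𝟙 (not (p i))) ⟩
    𝟙 (p i) * f i + 𝟙 (not (p i)) * f i   ∎
    where open ≡-Reasoning

upper : ∀ {n} → (Fin n → Fin n → ℕ) → Fin n → Fin n → ℕ
upper f i j = 𝟙 (toℕ i <ᵇ toℕ j) * f i j

module _ {n} (f : Fin n → Fin n → ℕ) (f-sym : ∀ i j → f i j ≡ f j i) (f-diag : ∀ i → f i i ≡ 0) where

  upper+lower : ∀ i j → f i j ≡ upper f i j + upper f j i
  upper+lower i j with <-cmp (toℕ i) (toℕ j)
  ... | tri< i<j _ j≮i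
    rewrite 𝟙-<ᵇ-< i<j | 𝟙-<ᵇ-≮ j≮i = sym (trans (+-identityʳ _) (+-identityʳ _))
  ... | tri≈ _ i≡j _ rewrite toℕ-injective i≡j | f-diag j =
    sym (cong₂ _+_ (*-zeroʳ (𝟙 (toℕ j <ᵇ toℕ j))) (*-zeroʳ (𝟙 (toℕ j <ᵇ toℕ j))))
  ... | tri> i≮j _ j<i
    rewrite 𝟙-<ᵇ-≮ i≮j | 𝟙-<ᵇ-< j<i = trans (f-sym i j) (sym (+-identityʳ _))

  ∑∑-symmetric : ∑[ i < n ] ∑[ j < n ] f i j
               ≡ ∑[ i < n ] ∑[ j < n ] upper f i j + ∑[ i < n ] ∑[ j < n ] upper f i j
  ∑∑-symmetric = begin
    ∑[ i < n ] ∑[ j < n ] f i j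
      ≡⟨ sum-cong-≗ (λ i → sum-cong-≗ (upper+lower i)) ⟩
    ∑[ i < n ] ∑[ j < n ] (upper f i j + upper f j i)
      ≡⟨ sum-cong-≗ (λ i → ∑-distrib-+ (upper f i) (flip (upper f) i)) ⟩
    ∑[ i < n ] (∑[ j < n ] upper f i j + ∑[ j < n ] upper f j i)
      ≡⟨ ∑-distrib-+ (λ i → ∑[ j < n ] upper f i j) (λ i → ∑[ j < n ] upper f j i) ⟩
    ∑[ i < n ] ∑[ j < n ] upper f i j + ∑[ i < n ] ∑[ j < n ] upper f j i
      ≡⟨ cong (∑[ i < n ] ∑[ j < n ] upper f i j +_) (∑-comm (flip (upper f))) ⟩
    ∑[ i < n ] ∑[ j < n ] upper f i j + ∑[ i < n ] ∑[ j < n ] upper f i j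
      ∎
    where open ≡-Reasoning

AllPairs-reverse : {R : Rel A ℓ} {xs : List A} → AllPairs R xs → AllPairs (flip R) (reverse xs)
AllPairs-reverse {xs = []}     []          = []
AllPairs-reverse {xs = x ∷ xs} (Rx ∷ Rxs) rewrite unfold-reverse x xs =
  AllPairs.++⁺ (AllPairs-reverse Rxs) ([] ∷ [])
               (All.map (_∷ []) (All-resp-↭ (↭-sym (↭-reverse xs)) Rx))

sum-take≤sum-take-∷ : ∀ {z} k {zs} → All (_≤ z) zs → sum (take k zs) ≤ sum (take k (z ∷ zs))
sum-take≤sum-take-∷     zero          _               = z≤n
sum-take≤sum-take-∷     (suc k)       []              = z≤n
sum-take≤sum-take-∷     (suc zero)    (w≤z ∷ _)       = +-monoˡ-≤ 0 w≤z
sum-take≤sum-take-∷ {z} (suc (suc k)) {w ∷ ws} (_ ∷ ws≤z) = begin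
  w + sum (take (suc k) ws)   ≤⟨ +-monoʳ-≤ w (sum-take≤sum-take-∷ (suc k) ws≤z) ⟩
  w + (z + sum (take k ws))   ≡⟨ x∙yz≈y∙xz w z _ ⟩
  z + (w + sum (take k ws))   ∎
  where open ≤-Reasoning

markedValue : ℕ × Bool → ℕ
markedValue (d , b) = 𝟙 b * d

markedSum : List (ℕ × Bool) → ℕ
markedSum P = sum (map markedValue P)

-- The largest value z is either selected, and then matched by the first entry of the
-- prefix, or not, and then the prefix may as well start with z.
markedSum≤sum-take : ∀ {zs} → AllPairs _≥_ zs → ∀ P → zs ↭ map proj₁ P →
                     markedSum P ≤ sum (take (count proj₂ P) zs)
markedSum≤sum-take [] []      _    = z≤n
markedSum≤sum-take [] (_ ∷ _) []↭P with () ← ↭-empty-inv (↭-sym []↭P)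
markedSum≤sum-take {z ∷ zs} (z≥zs ∷ zs-sorted) P z∷zs↭P
  with (.z , b) , zb∈P , refl ← ∈-map⁻ proj₁ (∈-resp-↭ z∷zs↭P (here refl))
  with P₁ , P₂ , refl ← ∈-∃++ zb∈P =
  subst₂ (λ s k → s ≤ sum (take k (z ∷ zs)))
         (sym (sum-↭ (map⁺ markedValue moved))) (sym (count-↭ proj₂ moved)) (select b)
  where
  P′ = P₁ ++ P₂
  moved : P₁ ++ [ z , b ] ++ P₂ ↭ (z , b) ∷ P′
  moved = shift (z , b) P₁ P₂

  rest : markedSum P′ ≤ sum (take (count proj₂ P′) zs)
  rest = markedSum≤sum-take zs-sorted P′ (drop-∷ (↭-trans z∷zs↭P (map⁺ proj₁ moved)))

  select : ∀ b → markedSum ((z , b) ∷ P′) ≤ sum (take (count proj₂ ((z , b) ∷ P′)) (z ∷ zs))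
  select true  = +-mono-≤ (≤-reflexive (*-identityˡ z)) rest
  select false = ≤-trans rest (sum-take≤sum-take-∷ (count proj₂ P′) z≥zs)

∑-selected≤sum-take : ∀ {n zs} (w : Fin n → ℕ) (sel : Fin n → Bool) →
  AllPairs _≥_ zs → zs ↭ map w (allFin n) →
  ∑[ i < n ] (𝟙 (sel i) * w i) ≤ sum (take (count sel (allFin n)) zs)
∑-selected≤sum-take {n} {zs} w sel zs-sorted zs↭w =
  subst₂ (λ s k → s ≤ sum (take k zs))
         (trans (cong sum (sym (map-∘ {g = markedValue} {f = mark} (allFin n))))
                (sum-map-allFin n (markedValue ∘ mark)))
         (count-map proj₂ mark (allFin n))
         (markedSum≤sum-take zs-sorted P (subst (zs ↭_) (map-∘ {g = proj₁} {f = mark} (allFin n)) zs↭w))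
  where
  mark : Fin n → ℕ × Bool
  mark i = w i , sel i

  P : List (ℕ × Bool)
  P = map mark (allFin n)

module _ {N} (G : SimpleGraph N) where

  degreeSeq-↭ : degreeSeq G ↭ map (degree G) (allFin N)
  degreeSeq-↭ = ↭-trans (↭-reverse _) (sort-↭ _)

  degreeSeq-nonincreasing : AllPairs _≥_ (degreeSeq G)
  degreeSeq-nonincreasing = AllPairs-reverse (Linked⇒AllPairs ≤-trans (sort-↗ _))

  tailSum+headSum : ∀ n₁ → tailSum G n₁ + headSum G (N ∸ n₁) ≡ ∑[ i < N ] degree G i
  tailSum+headSum n₁ = begin
    sum (drop k ds) + sum (take k ds)   ≡⟨ +-comm (sum (drop k ds)) _ ⟩
    sum (take k ds) + sum (drop k ds)   ≡⟨ sum-++ (take k ds) (drop k ds) ⟨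
    sum (take k ds ++ drop k ds)        ≡⟨ cong sum (take++drop≡id k ds) ⟩
    sum ds                              ≡⟨ sum-↭ degreeSeq-↭ ⟩
    sum (map (degree G) (allFin N))     ≡⟨ sum-map-allFin N (degree G) ⟩
    ∑[ i < N ] degree G i               ∎
    where
    open ≡-Reasoning
    k = N ∸ n₁
    ds = degreeSeq G

  ∑-selected-degree≤headSum : ∀ (sel : Fin N → Bool) →
    ∑[ i < N ] (𝟙 (sel i) * degree G i) ≤ headSum G (count sel (allFin N))
  ∑-selected-degree≤headSum sel =
    ∑-selected≤sum-take (degree G) sel degreeSeq-nonincreasing degreeSeq-↭

  module _ (c : Fin N → Bool) where

    inside leaving : Fin N → Fin N → ℕ
    inside  i j = 𝟙 (adj G i j ∧ c i ∧ c j)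
    leaving i j = 𝟙 (adj G i j ∧ c i ∧ not (c j))

    m11≡∑∑upper : m11 G c ≡ ∑[ i < N ] ∑[ j < N ] upper inside i j
    m11≡∑∑upper = begin
      m11 G c
        ≡⟨ count-cartesianProduct _ (allFin N) (allFin N) ⟩
      sum (map (λ i → count (edge₁₁ i) (allFin N)) (allFin N))
        ≡⟨ sum-map-allFin N (λ i → count (edge₁₁ i) (allFin N)) ⟩
      ∑[ i < N ] count (edge₁₁ i) (allFin N)
        ≡⟨ sum-cong-≗ (λ i → count-allFin N (edge₁₁ i)) ⟩
      ∑[ i < N ] ∑[ j < N ] 𝟙 (edge₁₁ i j)
        ≡⟨ sum-cong-≗ (λ i → sum-cong-≗ (λ j → 𝟙-∧ (toℕ i <ᵇ toℕ j) (adj G i j ∧ c i ∧ c j))) ⟩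
      ∑[ i < N ] ∑[ j < N ] upper inside i j
        ∎
      where
      open ≡-Reasoning
      edge₁₁ : Fin N → Fin N → Bool
      edge₁₁ i j = (toℕ i <ᵇ toℕ j) ∧ adj G i j ∧ c i ∧ c j

    ∑∑inside≡m11+m11 : ∑[ i < N ] ∑[ j < N ] inside i j ≡ m11 G c + m11 G c
    ∑∑inside≡m11+m11 = trans (∑∑-symmetric inside inside-sym inside-diag)
                             (sym (cong₂ _+_ m11≡∑∑upper m11≡∑∑upper))
      where
      inside-sym : ∀ i j → inside i j ≡ inside j i
      inside-sym i j rewrite adj-sym G i j = cong (λ x → 𝟙 (adj G j i ∧ x)) (∧-comm (c i) (c j))

      inside-diag : ∀ i → inside i i ≡ 0
      inside-diag i rewrite adj-irrefl G i = refl

    ∑-degree-ones : ∑[ i < N ] (𝟙 (c i) * degree G i)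
                  ≡ ∑[ i < N ] ∑[ j < N ] inside i j + ∑[ i < N ] ∑[ j < N ] leaving i j
    ∑-degree-ones = begin
      ∑[ i < N ] (𝟙 (c i) * degree G i)
        ≡⟨ sum-cong-≗ (λ i → cong (𝟙 (c i) *_) (count-allFin N (adj G i))) ⟩
      ∑[ i < N ] (𝟙 (c i) * ∑[ j < N ] 𝟙 (adj G i j))
        ≡⟨ sum-cong-≗ (λ i → *-distribˡ-sum (𝟙 (c i)) (λ j → 𝟙 (adj G i j))) ⟩
      ∑[ i < N ] ∑[ j < N ] (𝟙 (c i) * 𝟙 (adj G i j))
        ≡⟨ sum-cong-≗ (λ i → sum-cong-≗ (λ j → 𝟙-split (adj G i j) (c i) (c j))) ⟩
      ∑[ i < N ] ∑[ j < N ] (inside i j + leaving i j)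
        ≡⟨ sum-cong-≗ (λ i → ∑-distrib-+ (inside i) (leaving i)) ⟩
      ∑[ i < N ] (∑[ j < N ] inside i j + ∑[ j < N ] leaving i j)
        ≡⟨ ∑-distrib-+ (λ i → ∑[ j < N ] inside i j) (λ i → ∑[ j < N ] leaving i j) ⟩
      ∑[ i < N ] ∑[ j < N ] inside i j + ∑[ i < N ] ∑[ j < N ] leaving i j
        ∎
      where open ≡-Reasoning

    ∑∑leaving≤∑-degree-zeros : ∑[ i < N ] ∑[ j < N ] leaving i j ≤ ∑[ j < N ] (𝟙 (not (c j)) * degree G j)
    ∑∑leaving≤∑-degree-zeros = begin
      ∑[ i < N ] ∑[ j < N ] leaving i j
        ≡⟨ ∑-comm leaving ⟩
      ∑[ j < N ] ∑[ i < N ] leaving i j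
        ≤⟨ ∑-mono-≤ N (λ j → ∑-mono-≤ N (λ i → leaving≤ i j)) ⟩
      ∑[ j < N ] ∑[ i < N ] (𝟙 (not (c j)) * 𝟙 (adj G j i))
        ≡⟨ sum-cong-≗ (λ j → *-distribˡ-sum (𝟙 (not (c j))) (λ i → 𝟙 (adj G j i))) ⟨
      ∑[ j < N ] (𝟙 (not (c j)) * ∑[ i < N ] 𝟙 (adj G j i))
        ≡⟨ sum-cong-≗ (λ j → cong (𝟙 (not (c j)) *_) (count-allFin N (adj G j))) ⟨
      ∑[ j < N ] (𝟙 (not (c j)) * degree G j)
        ∎
      where
      open ≤-Reasoning
      leaving≤ : ∀ i j → leaving i j ≤ 𝟙 (not (c j)) * 𝟙 (adj G j i)
      leaving≤ i j rewrite adj-sym G j i = 𝟙-∧-≤ (adj G i j) (c i) (not (c j))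

count-zeros : ∀ {N n₁} (c : Fin N → Bool) → numOnes c ≡ n₁ → count (not ∘ c) (allFin N) ≡ N ∸ n₁
count-zeros {N} c refl = begin
  count (not ∘ c) (allFin N)                              ≡⟨ m+n∸m≡n (numOnes c) _ ⟨
  numOnes c + count (not ∘ c) (allFin N) ∸ numOnes c      ≡⟨ cong (_∸ numOnes c) (count+count-not c (allFin N)) ⟩
  length (allFin N) ∸ numOnes c                           ≡⟨ cong (_∸ numOnes c) (length-tabulate id) ⟩
  N ∸ numOnes c                                           ∎
  where open ≡-Reasoning

∸-half≤ : ∀ m n o → m ≤ o + o + n → (m ∸ n) / 2 ≤ o
∸-half≤ m n o m≤ = begin
  (m ∸ n) / 2   ≤⟨ /-mono-≤ (m≤n+o⇒m∸n≤o m n (≤-trans m≤ (≤-reflexive (+-comm (o + o) n)))) ≤-refl ⟩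
  (o + o) / 2   ≡⟨ cong (_/ 2) (trans (cong (o +_) (sym (+-identityʳ o))) (*-comm 2 o)) ⟩
  o * 2 / 2     ≡⟨ m*n/n≡m o 2 ⟩
  o             ∎
  where open ≤-Reasoning

proposition3p3 : (N : ℕ) (G : SimpleGraph N) → Connected G →
    (n1 : ℕ) → n1 ≤ N → (c : Fin N → Bool) → numOnes c ≡ n1 →
    LBm11 G n1 ≤ m11 G c
proposition3p3 N G _ n1 _ c ones = ∸-half≤ tail head M (+-cancelʳ-≤ head tail _ (begin
  tail + head                                     ≡⟨ tailSum+headSum G n1 ⟩
  ∑[ i < N ] degree G i                           ≡⟨ ∑-split N c (degree G) ⟩
  ∑[ i < N ] (𝟙 (c i) * degree G i) + zeros       ≡⟨ cong (_+ zeros) (∑-degree-ones G c) ⟩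
  (∑∑ (inside G c) + ∑∑ (leaving G c)) + zeros
    ≤⟨ +-monoˡ-≤ zeros (+-mono-≤ (≤-reflexive (∑∑inside≡m11+m11 G c)) (∑∑leaving≤∑-degree-zeros G c)) ⟩
  (M + M + zeros) + zeros                         ≤⟨ +-mono-≤ (+-monoʳ-≤ (M + M) zeros≤head) zeros≤head ⟩
  (M + M + head) + head                           ∎))
  where
  open ≤-Reasoning
  tail = tailSum G n1
  head = headSum G (N ∸ n1)
  M = m11 G c
  zeros = ∑[ i < N ] (𝟙 (not (c i)) * degree G i)
  ∑∑ : (Fin N → Fin N → ℕ) → ℕ
  ∑∑ f = ∑[ i < N ] ∑[ j < N ] f i j
  zeros≤head : zeros ≤ head
  zeros≤head = subst (λ k → zeros ≤ headSum G k) (count-zeros c ones) (∑-selected-degree≤headSum G (not ∘ c))
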